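{- If $n\geq1$ and $n\equiv1\pmod 4$, then $x_n^{(4)}\equiv4\pmod 8$ and $x_{n+8}^{(4)}-x_n^{(4)}=16$.
   Context: $t(m)\in\{0,1\}$ is the parity of the number of ones in the binary expansion of $m$. Define $x_1^{(4)}=4$ and, for $n\ge2$, $x_n^{(4)}$ is the smallest integer $y>x_{n-1}^{(4)}$ with $t(y)=t(n)$. -}

module Defs where

open import Data.Nat using (ℕ; zero; suc; _+_; _∸_; _<_; _≤_)
open import Data.Nat.DivMod using (_/_; _%_)
open import Relation.Binary.PropositionalEquality using (_≡_)
open import Data.Product using (_×_)

-- number of ones in the binary expansion of m, computed with fuel;
-- with fuel ≥ m the result is exact (each step halves m).
onesF : ℕ → ℕ → ℕ
onesF zero    m = 0
onesF (suc k) m = m % 2 + onesF k (m / 2)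

ones : ℕ → ℕ
ones m = onesF m m

t : ℕ → ℕ
t m = ones m % 2

-- x is the sequence x^(4): x 1 = 4 and, for n ≥ 2, x n is the smallest
-- y > x (n-1) with t y = t n.  (x 0 is irrelevant.)
IsX4 : (ℕ → ℕ) → Set
IsX4 x =
  (x 1 ≡ 4) ×
  (∀ n → 2 ≤ n →
     (x (n ∸ 1) < x n) × (t (x n) ≡ t n) ×
     (∀ y → x (n ∸ 1) < y → t y ≡ t n → x n ≤ y))

-- Thue–Morse is additive over binary blocks: for j < 2^a the number of ones
-- of j + 2^a k is ones j + ones k.  Hence in the window n = 8k+1, …, 8k+9 and
-- y = 16k+4, …, 16k+20 every t n and t y is fixed by the parity of ones k or of
-- ones (k+1), and running the greedy rule from x (8k+1) = 16k+4 gives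
-- x (8k+5) = 16k+12 and x (8k+9) = 16(k+1)+4.  Only x (8k+7) depends on whether
-- t k = t (k+1), and both outcomes lead to x (8k+8) = 16k+19.
module Submission where

open import Defs
open import Data.Nat using (ℕ; _+_; _∸_; _≤_)
open import Data.Nat.DivMod using (_%_)
open import Relation.Binary.PropositionalEquality using (_≡_)
open import Data.Product using (_×_)

open import Data.Bool.Base using (T)
open import Data.Nat using (zero; suc; _*_; _^_; _<_; _<ᵇ_; z≤n; s≤s; NonZero)
open import Data.Nat.Properties
open import Data.Nat.DivMod using (_/_; m/n<m; m*n/n≡m; m<n*o⇒m/o<n; [m+kn]%n≡m%n; %-distribˡ-+; %-remove-+ʳ; +-distrib-/-∣ʳ; m%n<n)
open import Data.Nat.Divisibility using (n∣m*n; n∣m*n*o)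
open import Data.Product using (_,_; proj₁; proj₂; ∃-syntax)
open import Data.Sum using (_⊎_; inj₁; inj₂)
open import Function.Base using (_|>_)
open import Relation.Binary.PropositionalEquality using (refl; sym; trans; cong; cong₂; _≢_; module ≡-Reasoning)
open import Relation.Nullary using (yes; no; contradiction)

open ≡-Reasoning

onesF-zero : ∀ f → onesF f 0 ≡ 0
onesF-zero zero    = refl
onesF-zero (suc f) = onesF-zero f

onesF-fuel-irrelevant : ∀ f g m → m ≤ f → m ≤ g → onesF f m ≡ onesF g m
onesF-fuel-irrelevant f g zero _ _ = trans (onesF-zero f) (sym (onesF-zero g))
onesF-fuel-irrelevant (suc f) (suc g) m@(suc _) m≤1+f m≤1+g =
  cong (m % 2 +_) (onesF-fuel-irrelevant f g (m / 2) (halve m≤1+f) (halve m≤1+g))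
  where
  halve : ∀ {h} → m ≤ suc h → m / 2 ≤ h
  halve m≤1+h = ≤-pred (<-≤-trans (m/n<m m 2 (n<1+n 1)) m≤1+h)

ones-step : ∀ n → ones n ≡ n % 2 + ones (n / 2)
ones-step zero      = refl
ones-step n@(suc p) =
  cong (n % 2 +_) (onesF-fuel-irrelevant p (n / 2) (n / 2) (≤-pred (m/n<m n 2 (n<1+n 1))) ≤-refl)

ones-block : ∀ a j k → j < 2 ^ a → ones (j + 2 ^ a * k) ≡ ones j + ones k
ones-block zero    zero    k _ = cong ones (*-identityˡ k)
ones-block zero    (suc j) k (s≤s ())
ones-block (suc a) j       k j<2^[1+a] = begin
  ones (j + 2 ^ suc a * k)                   ≡⟨ cong (λ y → ones (j + y)) 2^[1+a]*k≡m*2 ⟩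
  ones (j + m * 2)                           ≡⟨ ones-step (j + m * 2) ⟩
  (j + m * 2) % 2 + ones ((j + m * 2) / 2)   ≡⟨ cong₂ _+_ ([m+kn]%n≡m%n j m 2) (cong ones [j+m*2]/2≡j/2+m) ⟩
  j % 2 + ones (j / 2 + m)                   ≡⟨ cong (j % 2 +_) (ones-block a (j / 2) k j/2<2^a) ⟩
  j % 2 + (ones (j / 2) + ones k)            ≡⟨ +-assoc (j % 2) (ones (j / 2)) (ones k) ⟨
  j % 2 + ones (j / 2) + ones k              ≡⟨ cong (_+ ones k) (ones-step j) ⟨
  ones j + ones k                            ∎
  where
  m = 2 ^ a * k
  2^[1+a]*k≡m*2 : 2 ^ suc a * k ≡ m * 2
  2^[1+a]*k≡m*2 = trans (*-assoc 2 (2 ^ a) k) (*-comm 2 m)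
  [j+m*2]/2≡j/2+m : (j + m * 2) / 2 ≡ j / 2 + m
  [j+m*2]/2≡j/2+m = trans (+-distrib-/-∣ʳ j (n∣m*n m)) (cong (j / 2 +_) (m*n/n≡m m 2))
  j/2<2^a : j / 2 < 2 ^ a
  j/2<2^a = m<n*o⇒m/o<n (<-≤-trans j<2^[1+a] (≤-reflexive (*-comm 2 (2 ^ a))))

t-block : ∀ a j k → j < 2 ^ a → t (j + 2 ^ a * k) ≡ (ones j + ones k) % 2
t-block a j k j<2^a = cong (_% 2) (ones-block a j k j<2^a)

t-next-block : ∀ a j k → j < 2 ^ a → t (j + (2 ^ a + 2 ^ a * k)) ≡ (ones j + ones (suc k)) % 2
t-next-block a j k j<2^a =
  trans (cong (λ y → t (j + y)) (sym (*-suc (2 ^ a) k))) (t-block a j (suc k) j<2^a)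

+-cong-mod : ∀ m n o d .{{_ : NonZero d}} → m % d ≡ n % d → (m + o) % d ≡ (n + o) % d
+-cong-mod m n o d m≡n = begin
  (m + o) % d               ≡⟨ %-distribˡ-+ m o d ⟩
  (m % d + o % d) % d       ≡⟨ cong (λ r → (r + o % d) % d) m≡n ⟩
  (n % d + o % d) % d       ≡⟨ %-distribˡ-+ n o d ⟨
  (n + o) % d               ∎

-- adding o another d ∸ 1 times adds a multiple of d
+-cancel-mod : ∀ m n o d .{{_ : NonZero d}} → (m + o) % d ≡ (n + o) % d → m % d ≡ n % d
+-cancel-mod m n o d@(suc d-1) m+o≡n+o = begin
  m % d                     ≡⟨ [m+kn]%n≡m%n m o d ⟨
  (m + o * d) % d           ≡⟨ cong (_% d) (regroup m) ⟩
  (m + o + o * d-1) % d     ≡⟨ +-cong-mod (m + o) (n + o) (o * d-1) d m+o≡n+o ⟩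
  (n + o + o * d-1) % d     ≡⟨ cong (_% d) (regroup n) ⟨
  (n + o * d) % d           ≡⟨ [m+kn]%n≡m%n n o d ⟩
  n % d                     ∎
  where
  regroup : ∀ l → l + o * d ≡ l + o + o * d-1
  regroup l = trans (cong (l +_) (*-suc o d-1)) (sym (+-assoc l o (o * d-1)))

m%2≢n⇒[1+m]%2≡n : ∀ m {n} → n < 2 → m % 2 ≢ n → suc m % 2 ≡ n
m%2≢n⇒[1+m]%2≡n (suc (suc m)) n<2 m%2≢n = m%2≢n⇒[1+m]%2≡n m n<2 m%2≢n
m%2≢n⇒[1+m]%2≡n 0 {0} _ 0≢0 = contradiction refl 0≢0
m%2≢n⇒[1+m]%2≡n 0 {1} _ _   = refl
m%2≢n⇒[1+m]%2≡n 1 {0} _ _   = refl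
m%2≢n⇒[1+m]%2≡n 1 {1} _ 1≢1 = contradiction refl 1≢1
m%2≢n⇒[1+m]%2≡n _ {suc (suc _)} (s≤s (s≤s ())) _

module Greedy {x : ℕ → ℕ} (isX4 : IsX4 x) where

  Searching : ℕ → ℕ → Set
  Searching m b = x (m ∸ 1) < b × b ≤ x m

  module _ {n : ℕ} where
    private
      m = 2 + n
      x-spec = proj₂ isX4 m (s≤s (s≤s z≤n))

    search-start : ∀ {a} → x (1 + n) ≡ a → Searching m (suc a)
    search-start refl = ≤-refl , proj₁ x-spec

    search-skip : ∀ {b} → t b ≢ t m → Searching m b → Searching m (suc b)
    search-skip tb≢tm (prev<b , b≤xm) =
      m<n⇒m<1+n prev<b , ≤∧≢⇒< b≤xm (λ b≡xm → tb≢tm (trans (cong t b≡xm) (proj₁ (proj₂ x-spec))))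

    search-hit : ∀ {b} → t b ≡ t m → Searching m b → x m ≡ b
    search-hit tb≡tm (prev<b , b≤xm) = ≤-antisym (proj₂ (proj₂ x-spec) _ prev<b tb≡tm) b≤xm

module _ {x : ℕ → ℕ} (isX4 : IsX4 x) where
  open Greedy isX4

  block-step : ∀ k → x (1 + 8 * k) ≡ 4 + 16 * k →
               x (5 + 8 * k) ≡ 12 + 16 * k × x (9 + 8 * k) ≡ 20 + 16 * k
  block-step k x₁ = x₅ , x₉
    where
    t-n : ∀ j → T (j <ᵇ 8) → t (j + 8 * k) ≡ (ones j + ones k) % 2
    t-n j j<8 = t-block 3 j k (<ᵇ⇒< j 8 j<8)
    t-y : ∀ j → T (j <ᵇ 16) → t (j + 16 * k) ≡ (ones j + ones k) % 2
    t-y j j<16 = t-block 4 j k (<ᵇ⇒< j 16 j<16)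
    t-n⁺ : ∀ j → T (j <ᵇ 8) → t (j + (8 + 8 * k)) ≡ (ones j + ones (suc k)) % 2
    t-n⁺ j j<8 = t-next-block 3 j k (<ᵇ⇒< j 8 j<8)
    t-y⁺ : ∀ j → T (j <ᵇ 16) → t (j + (16 + 16 * k)) ≡ (ones j + ones (suc k)) % 2
    t-y⁺ j j<16 = t-next-block 4 j k (<ᵇ⇒< j 16 j<16)

    agree : ∀ i j {i<16 : T (i <ᵇ 16)} {j<8 : T (j <ᵇ 8)} →
            ones i % 2 ≡ ones j % 2 → t (i + 16 * k) ≡ t (j + 8 * k)
    agree i j {i<16} {j<8} e =
      trans (t-y i i<16) (trans (+-cong-mod (ones i) (ones j) (ones k) 2 e) (sym (t-n j j<8)))
    differ : ∀ i j {i<16 : T (i <ᵇ 16)} {j<8 : T (j <ᵇ 8)} →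
             ones i % 2 ≢ ones j % 2 → t (i + 16 * k) ≢ t (j + 8 * k)
    differ i j {i<16} {j<8} e≢ ti≡tj =
      e≢ (+-cancel-mod (ones i) (ones j) (ones k) 2 (trans (sym (t-y i i<16)) (trans ti≡tj (t-n j j<8))))
    agree⁺ : ∀ i j {i<16 : T (i <ᵇ 16)} {j<8 : T (j <ᵇ 8)} →
             ones i % 2 ≡ ones j % 2 → t (i + (16 + 16 * k)) ≡ t (j + (8 + 8 * k))
    agree⁺ i j {i<16} {j<8} e =
      trans (t-y⁺ i i<16) (trans (+-cong-mod (ones i) (ones j) (ones (suc k)) 2 e) (sym (t-n⁺ j j<8)))
    differ⁺ : ∀ i j {i<16 : T (i <ᵇ 16)} {j<8 : T (j <ᵇ 8)} →
              ones i % 2 ≢ ones j % 2 → t (i + (16 + 16 * k)) ≢ t (j + (8 + 8 * k))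
    differ⁺ i j {i<16} {j<8} e≢ ti≡tj =
      e≢ (+-cancel-mod (ones i) (ones j) (ones (suc k)) 2 (trans (sym (t-y⁺ i i<16)) (trans ti≡tj (t-n⁺ j j<8))))

    x₂ : x (2 + 8 * k) ≡ 7 + 16 * k
    x₂ = search-start x₁
      |> search-skip (differ 5 2 λ ())
      |> search-skip (differ 6 2 λ ())
      |> search-hit  (agree 7 2 refl)

    x₃ : x (3 + 8 * k) ≡ 9 + 16 * k
    x₃ = search-start x₂
      |> search-skip (differ 8 3 λ ())
      |> search-hit  (agree 9 3 refl)

    x₄ : x (4 + 8 * k) ≡ 11 + 16 * k
    x₄ = search-start x₃
      |> search-skip (differ 10 4 λ ())
      |> search-hit  (agree 11 4 refl)

    x₅ : x (5 + 8 * k) ≡ 12 + 16 * k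
    x₅ = search-start x₄
      |> search-hit  (agree 12 5 refl)

    x₆ : x (6 + 8 * k) ≡ 15 + 16 * k
    x₆ = search-start x₅
      |> search-skip (differ 13 6 λ ())
      |> search-skip (differ 14 6 λ ())
      |> search-hit  (agree 15 6 refl)

    -- x (7 + 8k) is whichever of 16k+16, 16k+17 has the right parity.
    searching₈ : Searching (8 + 8 * k) (18 + 16 * k)
    searching₈ with t (16 + 16 * k) ≟ t (7 + 8 * k)
    ... | yes t₁₆≡t₇ = search-start x₆
      |> search-hit  t₁₆≡t₇
      |> search-start
      |> search-skip (differ⁺ 1 0 λ ())
    ... | no t₁₆≢t₇ = search-start x₆
      |> search-skip t₁₆≢t₇
      |> search-hit  t₁₇≡t₇
      |> search-start
      where
      t₁₇≡t₇ : t (17 + 16 * k) ≡ t (7 + 8 * k)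
      t₁₇≡t₇ = trans (t-y⁺ 1 _)
        (m%2≢n⇒[1+m]%2≡n (ones (suc k)) (m%n<n (ones (7 + 8 * k)) 2) v%2≢t₇)
        where
        v%2≢t₇ : ones (suc k) % 2 ≢ t (7 + 8 * k)
        v%2≢t₇ v≡t₇ = t₁₆≢t₇ (trans (t-y⁺ 0 _) v≡t₇)

    x₈ : x (8 + 8 * k) ≡ 19 + 16 * k
    x₈ = searching₈
      |> search-skip (differ⁺ 2 0 λ ())
      |> search-hit  (agree⁺ 3 0 refl)

    x₉ : x (9 + 8 * k) ≡ 20 + 16 * k
    x₉ = search-start x₈
      |> search-hit  (agree⁺ 4 1 refl)

  x[1+8k]≡4+16k : ∀ k → x (1 + 8 * k) ≡ 4 + 16 * k
  x[1+8k]≡4+16k zero = proj₁ isX4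
  x[1+8k]≡4+16k (suc k) = begin
    x (1 + 8 * suc k)     ≡⟨ cong (λ y → x (1 + y)) (*-suc 8 k) ⟩
    x (9 + 8 * k)         ≡⟨ proj₂ (block-step k (x[1+8k]≡4+16k k)) ⟩
    20 + 16 * k           ≡⟨ cong (4 +_) (*-suc 16 k) ⟨
    4 + 16 * suc k        ∎

  x[5+8k]≡12+16k : ∀ k → x (5 + 8 * k) ≡ 12 + 16 * k
  x[5+8k]≡12+16k k = proj₁ (block-step k (x[1+8k]≡4+16k k))

+-*-suc : ∀ m n o → m + n * o + n ≡ m + n * suc o
+-*-suc m n o = trans (+-assoc m (n * o) n) (cong (m +_) (trans (+-comm (n * o) n) (sym (*-suc n o))))

residue-and-increment : ∀ (f : ℕ → ℕ) r c → c % 8 ≡ 4 → (∀ k → f (r + 8 * k) ≡ c + 16 * k) →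
  ∀ k → (f (r + 8 * k) % 8 ≡ 4) × (f (r + 8 * k + 8) ≡ f (r + 8 * k) + 16)
residue-and-increment f r c c%8≡4 f≡ k = residue , increment
  where
  residue : f (r + 8 * k) % 8 ≡ 4
  residue = begin
    f (r + 8 * k) % 8     ≡⟨ cong (_% 8) (f≡ k) ⟩
    (c + 16 * k) % 8      ≡⟨ %-remove-+ʳ c (n∣m*n*o 2 k) ⟩
    c % 8                 ≡⟨ c%8≡4 ⟩
    4                     ∎
  increment : f (r + 8 * k + 8) ≡ f (r + 8 * k) + 16
  increment = begin
    f (r + 8 * k + 8)     ≡⟨ cong f (+-*-suc r 8 k) ⟩
    f (r + 8 * suc k)     ≡⟨ f≡ (suc k) ⟩
    c + 16 * suc k        ≡⟨ +-*-suc c 16 k ⟨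
    c + 16 * k + 16       ≡⟨ cong (_+ 16) (f≡ k) ⟨
    f (r + 8 * k) + 16    ∎

%4≡1⇒1+8k∨5+8k : ∀ n → n % 4 ≡ 1 → ∃[ k ] (n ≡ 1 + 8 * k ⊎ n ≡ 5 + 8 * k)
%4≡1⇒1+8k∨5+8k 0 ()
%4≡1⇒1+8k∨5+8k 1 _ = 0 , inj₁ refl
%4≡1⇒1+8k∨5+8k 2 ()
%4≡1⇒1+8k∨5+8k 3 ()
%4≡1⇒1+8k∨5+8k 4 ()
%4≡1⇒1+8k∨5+8k 5 _ = 0 , inj₂ refl
%4≡1⇒1+8k∨5+8k 6 ()
%4≡1⇒1+8k∨5+8k 7 ()
%4≡1⇒1+8k∨5+8k (suc (suc (suc (suc (suc (suc (suc (suc n)))))))) n%4≡1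
  with %4≡1⇒1+8k∨5+8k n n%4≡1
... | k , inj₁ n≡ = suc k , inj₁ (trans (cong (8 +_) n≡) (cong suc (sym (*-suc 8 k))))
... | k , inj₂ n≡ = suc k , inj₂ (trans (cong (8 +_) n≡) (cong (5 +_) (sym (*-suc 8 k))))

corollary4 : (x : ℕ → ℕ) → IsX4 x → (n : ℕ) → 1 ≤ n → n % 4 ≡ 1 →
    (x n % 8 ≡ 4) × (x (n + 8) ≡ x n + 16)
corollary4 x isX4 n _ n%4≡1 with %4≡1⇒1+8k∨5+8k n n%4≡1
... | k , inj₁ refl = residue-and-increment x 1 4 refl (x[1+8k]≡4+16k isX4) k
... | k , inj₂ refl = residue-and-increment x 5 12 refl (x[5+8k]≡12+16k isX4) k
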